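{- Let $k\ge 2$, let $V=\{(i_1,\ldots,i_{k-1}) \mid 1\le i_j\le k \text{ for all } j\}$, and for $j=1,\ldots,k-1$ let $\mathcal{H}_j$ be the hypergraph on $V$ whose edges are the $k$-element sets $\{v^1,\ldots,v^k\}\subseteq V$ such that $\{v^1_j,\ldots,v^k_j\}=\{1,\ldots,k\}$ (where $v_j$ denotes the $j$-th coordinate of $v$). Then each $\mathcal{H}_j$ admits a polychromatic $k$-coloring, and the union hypergraph $\mathcal{H}_1\cup\cdots\cup\mathcal{H}_{k-1}$ (on vertex set $V$, with edge set the union of the edge sets) has chromatic number exactly $k$.
   Context: A $k$-coloring of a hypergraph with vertex set $V$ is a map $V\to\{1,\ldots,k\}$. It is polychromatic if every edge contains a vertex of each of the $k$ colors; it is proper if every edge of size at least two contains two vertices of different colors. The chromatic number is the least $k$ admitting a proper $k$-coloring. -}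

module Defs where

open import Data.Nat using (ℕ; suc; _≤_; _<_)
open import Data.Fin using (Fin)
open import Data.Vec using (Vec; lookup)
open import Data.List using (List; length)
open import Data.List.Membership.Propositional using (_∈_)
open import Data.List.Relation.Unary.Unique.Propositional using (Unique)
open import Data.Product using (Σ; _×_)

open import Relation.Binary.PropositionalEquality using (_≡_; _≢_)


-- A finite set of vertices is represented by a duplicate-free list
-- (its elements); edges are only ever duplicate-free lists (see below),
-- so an edge's size is the length of the list.
Hypergraph : Set → Set₁
Hypergraph V = List V → Set

⋃ : {V I : Set} → (I → Hypergraph V) → Hypergraph V
⋃ {I = I} H e = Σ I λ j → H j e

Coloring : Set → ℕ → Set
Coloring V k = V → Fin k

Polychromatic : {V : Set} {k : ℕ} → Hypergraph V → Coloring V k → Set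
Polychromatic {V} {k} H c =
  ∀ (e : List V) → H e → ∀ (col : Fin k) → Σ V λ v → v ∈ e × c v ≡ col

Proper : {V : Set} {k : ℕ} → Hypergraph V → Coloring V k → Set
Proper {V} H c =
  ∀ (e : List V) → H e → 2 ≤ length e →
    Σ V λ u → Σ V λ v → u ∈ e × v ∈ e × c u ≢ c v

ChromaticNumber : {V : Set} → Hypergraph V → ℕ → Set
ChromaticNumber {V} H k =
  (Σ (Coloring V k) λ c → Proper H c) ×
  (∀ (m : ℕ) → m < k → (c : Coloring V m) → Proper H c → Data.Empty.⊥)
  where import Data.Empty

-- The vertex set V = [k]^(k-1), with k = suc (suc n) (so k ≥ 2, k-1 = suc n);
-- coordinates are Fin k (0-based version of {1,…,k}).
Vtx : ℕ → Set
Vtx n = Vec (Fin (suc (suc n))) (suc n)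

H : (n : ℕ) → Fin (suc n) → Hypergraph (Vtx n)
H n j e =
  Unique e × length e ≡ suc (suc n) ×
  (∀ (i : Fin (suc (suc n))) → Σ (Vtx n) λ v → v ∈ e × lookup v j ≡ i)

{-# OPTIONS --safe #-}
-- The j-th coordinate is a polychromatic colouring of H_j. Colouring each
-- vertex by a value it does not take (one exists, as it has only k - 1
-- coordinates) is proper: an edge of H_j contains some u and a w with
-- w_j = colour(u), and colour(w) ≠ w_j. Conversely, index k - 1 colours by the
-- coordinates. If colour class i meets every hyperplane {v | v_i = a}, one
-- vertex from each hyperplane is a monochromatic edge of H_i. Otherwise every
-- class i avoids some hyperplane {v_i = a_i}, and the vertex (a_1,…,a_{k-1})
-- cannot be coloured at all.
module Submission where

open import Defs
open import Data.Nat using (ℕ; suc; _≤_; _<_; s≤s; z≤n)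
open import Data.Nat.Properties using (<⇒≱; n<1+n)
open import Data.Fin using (Fin; zero; inject≤; _≟_)
open import Data.Fin.Properties using (any?; ¬∀⟶∃¬; injective⇒≤; inject≤-injective)
open import Data.Product using (Σ; _×_; _,_; proj₁; proj₂; ∃; map₂)
open import Data.Vec using (Vec; []; _∷_; lookup; tabulate)
open import Data.Vec.Properties using (lookup∘tabulate)
import Data.List as List
open import Data.List using (List; length)
open import Data.List.Properties using (length-tabulate)
open import Data.List.Membership.Propositional using (_∈_)
open import Data.List.Membership.Propositional.Properties using (∈-tabulate⁺; ∈-tabulate⁻)
open import Data.List.Relation.Unary.Unique.Propositional.Properties using (tabulate⁺)
open import Function using (_∘_)
open import Function.Definitions using (Injective; StrictlySurjective)
open import Relation.Nullary using (¬_; Dec)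
open import Relation.Nullary.Decidable using (map′; _×-dec_)
open import Relation.Unary using (Pred; Decidable)
open import Relation.Binary.PropositionalEquality using (_≡_; _≢_; refl; sym; trans; cong; subst)

strictlySurjective⇒≥ : ∀ {m n} {f : Fin m → Fin n} → StrictlySurjective _≡_ f → n ≤ m
strictlySurjective⇒≥ {f = f} surj = injective⇒≤ section-injective
  where
    section-injective : Injective _≡_ _≡_ (proj₁ ∘ surj)
    section-injective {a} {b} eq =
      trans (sym (proj₂ (surj a))) (trans (cong f eq) (proj₂ (surj b)))

missingValue : ∀ {m n} → m < n → (v : Vec (Fin n) m) → ∃ λ a → ∀ j → lookup v j ≢ a
missingValue {n = n} m<n v =
  map₂ (λ notTaken j eq → notTaken (j , eq))
       (¬∀⟶∃¬ n Taken (λ a → any? (λ j → lookup v j ≟ a))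
              (<⇒≱ m<n ∘ strictlySurjective⇒≥))
  where
    Taken : Pred (Fin n) _
    Taken a = ∃ λ j → lookup v j ≡ a

anyVec? : ∀ {p k} n {P : Pred (Vec (Fin k) n) p} → Decidable P → Dec (∃ P)
anyVec? 0       P? = map′ (λ p → [] , p) (λ { ([] , p) → p }) (P? [])
anyVec? (suc n) P? =
  map′ (λ { (x , xs , p) → x ∷ xs , p }) (λ { (x ∷ xs , p) → x , xs , p })
       (any? (λ x → anyVec? n (λ xs → P? (x ∷ xs))))

Proper-∘-injective : ∀ {V k l} {G : Hypergraph V} {c : Coloring V k} {f : Fin k → Fin l} →
                     Injective _≡_ _≡_ f → Proper G c → Proper G (f ∘ c)
Proper-∘-injective f-inj proper e edge two with proper e edge two
... | u , v , u∈e , v∈e , cu≢cv = u , v , u∈e , v∈e , cu≢cv ∘ f-inj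

Proper⇒¬monochromatic : ∀ {V k} {G : Hypergraph V} {c : Coloring V k} {e : List V} →
                        Proper G c → G e → 2 ≤ length e →
                        ∀ col → ¬ (∀ {v} → v ∈ e → c v ≡ col)
Proper⇒¬monochromatic proper edge two col mono with proper _ edge two
... | u , v , u∈e , v∈e , cu≢cv = cu≢cv (trans (mono u∈e) (sym (mono v∈e)))

module _ (n : ℕ) where

  private
    K = suc (suc n)

  H-tabulate : ∀ j (W : Fin K → Vtx n) → (∀ a → lookup (W a) j ≡ a) → H n j (List.tabulate W)
  H-tabulate j W Wj≡ =
    tabulate⁺ W-injective , length-tabulate W , λ a → W a , ∈-tabulate⁺ {f = W} a , Wj≡ a
    where
      W-injective : Injective _≡_ _≡_ W
      W-injective {a} {b} eq = trans (sym (Wj≡ a)) (trans (cong (λ v → lookup v j) eq) (Wj≡ b))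

  coordinate-polychromatic : ∀ j → Polychromatic (H n j) (λ v → lookup v j)
  coordinate-polychromatic j e (_ , _ , covers) = covers

  vertexMissingValue : (v : Vtx n) → ∃ λ a → ∀ j → lookup v j ≢ a
  vertexMissingValue = missingValue (n<1+n (suc n))

  missingValueColoring : Coloring (Vtx n) K
  missingValueColoring = proj₁ ∘ vertexMissingValue

  missingValueColoring-proper : Proper (⋃ (H n)) missingValueColoring
  missingValueColoring-proper e (j , _ , _ , covers) _
    with u , u∈e , _ ← covers zero
    with w , w∈e , wj≡cu ← covers (missingValueColoring u)
    = u , w , u∈e , w∈e , λ cu≡cw → proj₂ (vertexMissingValue w) j (trans wj≡cu cu≡cw)

  ClassMeets : Coloring (Vtx n) (suc n) → Fin (suc n) → Fin K → Set
  ClassMeets c i a = ∃ λ v → c v ≡ i × lookup v i ≡ a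

  Proper⇒classAvoidsHyperplane : ∀ {c} i → Proper (H n i) c → ¬ (∀ a → ClassMeets c i a)
  Proper⇒classAvoidsHyperplane {c} i proper meets =
    Proper⇒¬monochromatic proper (H-tabulate i W (proj₂ ∘ proj₂ ∘ meets))
      (subst (2 ≤_) (sym (length-tabulate W)) (s≤s (s≤s z≤n))) i W-coloured-i
    where
      W : Fin K → Vtx n
      W = proj₁ ∘ meets
      W-coloured-i : ∀ {v} → v ∈ List.tabulate W → c v ≡ i
      W-coloured-i v∈ with a , refl ← ∈-tabulate⁻ {f = W} v∈ = proj₁ (proj₂ (meets a))

  ¬Proper-coordinateColours : (c : Coloring (Vtx n) (suc n)) → ¬ Proper (⋃ (H n)) c
  ¬Proper-coordinateColours c proper =
    proj₂ (avoided (c v)) (v , refl , lookup∘tabulate (proj₁ ∘ avoided) (c v))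
    where
      avoided : ∀ i → ∃ λ a → ¬ ClassMeets c i a
      avoided i = ¬∀⟶∃¬ K (ClassMeets c i)
        (λ a → anyVec? (suc n) (λ v → (c v ≟ i) ×-dec (lookup v i ≟ a)))
        (Proper⇒classAvoidsHyperplane i (λ e edge → proper e (i , edge)))
      v : Vtx n
      v = tabulate (proj₁ ∘ avoided)

  ¬Proper-fewerColours : ∀ m → m < K → (c : Coloring (Vtx n) m) → ¬ Proper (⋃ (H n)) c
  ¬Proper-fewerColours m (s≤s m≤k-1) c =
    ¬Proper-coordinateColours _ ∘ Proper-∘-injective (inject≤-injective m≤k-1 m≤k-1 _ _)

mainTheorem2 : (n : ℕ) →
    ((j : Fin (suc n)) → Σ (Coloring (Vtx n) (suc (suc n))) λ c → Polychromatic (H n j) c)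
    × ChromaticNumber (⋃ (H n)) (suc (suc n))
mainTheorem2 n =
  (λ j → (λ v → lookup v j) , coordinate-polychromatic n j) ,
  (missingValueColoring n , missingValueColoring-proper n) ,
  ¬Proper-fewerColours n
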